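{- Let $\mathbf a=(a_1,\dots,a_{10})\in\mathbb N^{10}$ with $(a_1,a_2)=(1,2)$ and let $\beta=-\mathbf e_1+\mathbf e_2\in\mathbb Z^{10}$; then $B_{\mathbf a}(\alpha,\beta)=1$. Moreover: (1) If at least three of $a_3,\dots,a_{10}$ (counted with multiplicity) are odd, then $L_{\mathbf a,\beta}\otimes\mathbb Z_2$ is even universal. (2) For any distinct indices $j_1,\dots,j_l\in\{3,\dots,10\}$ (in any order), put $\sigma=\sum_{k=1}^l a_{j_k}$. Then for every prime $p$, $L_{\mathbf a,\beta}\otimes\mathbb Z_p$ contains a $\mathbb Z_p$-sublattice isometric to $\langle b_0\rangle\perp\langle b_1\rangle\perp\cdots\perp\langle b_{l-1}\rangle$, where $$b_0=\Big(\frac{2\sigma}{\gcd(4,\sigma)}\Big)^2+2\Big(\frac{\sigma}{\gcd(4,\sigma)}\Big)^2+\sigma\Big(\frac{ -4}{\gcd(4,\sigma)}\Big)^2,\qquad b_h=a_{j_{h+1}}\Big(\sum_{k=1}^{h}a_{j_k}\Big)\Big(\sum_{k=1}^{h+1}a_{j_k}\Big)\ (1\le h\le l-1).$$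
   Context: $\mathbf e_i$ is the $i$-th standard basis vector. $Q_{\mathbf a}(\mathbf x)=\sum a_ix_i^2$, $B_{\mathbf a}(\mathbf x,\mathbf y)=\sum a_ix_iy_i$, $\alpha=(1,\dots,1)\in\mathbb Z^{10}$, $L_{\mathbf a,\beta}=\{\mathbf x\in\mathbb Z^{10}: B_{\mathbf a}(\alpha,\mathbf x)=B_{\mathbf a}(\beta,\mathbf x)=0\}$ with form $Q_{\mathbf a}$. A $\mathbb Z_2$-lattice is even universal if it represents every element of $2\mathbb Z_2$. $\langle c_1\rangle\perp\cdots$ denotes a diagonal lattice with form $c_1y_1^2+\cdots$. -}

module Defs where

open import Data.Nat as ℕ using (ℕ; zero; suc; NonZero; ≢-nonZero; _%_; _≡ᵇ_; _<ᵇ_)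
open import Data.Nat.GCD using (gcd; gcd[m,n]≢0)
open import Data.Nat.DivMod using (_/_)
open import Data.Integer as ℤ using (ℤ; +_; _+_; _*_; _-_; -_)
open import Data.Integer.Divisibility using (_∣_)
open import Data.Fin using (Fin; toℕ; zero; suc)
open import Data.Product using (Σ; _×_)
open import Data.Bool using (Bool; true; false; if_then_else_; _∧_)
open import Data.Sum using (inj₁)

Σℤ : ∀ {n} → (Fin n → ℤ) → ℤ
Σℤ {zero}  f = + 0
Σℤ {suc n} f = f zero + Σℤ (λ i → f (suc i))

Σℕ : ∀ {n} → (Fin n → ℕ) → ℕ
Σℕ {zero}  f = 0
Σℕ {suc n} f = f zero ℕ.+ Σℕ (λ i → f (suc i))

_≡_[mod_] : ℤ → ℤ → ℕ → Set
x ≡ y [mod m ] = (+ m) ∣ (x - y)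

-- p-adic integers ℤ_p, modelled as the inverse limit lim ℤ/p^k:
-- coherent sequences of integers, x_(k+1) ≡ x_k mod p^k.
-- The value at level k represents the element modulo p^k.
-- Ring operations on ℤ_p are computed levelwise, so an identity between
-- polynomial expressions in ℤ_p holds iff it holds mod p^k at every level k.
record ℤ[_] (p : ℕ) : Set where
  field
    at  : ℕ → ℤ
    coh : ∀ k → at (suc k) ≡ at k [mod p ℕ.^ k ]
open ℤ[_] public

Qℤ : (Fin 10 → ℕ) → (Fin 10 → ℤ) → ℤ
Qℤ a x = Σℤ (λ i → + a i * (x i * x i))

Bℤ : (Fin 10 → ℕ) → (Fin 10 → ℤ) → (Fin 10 → ℤ) → ℤ
Bℤ a x y = Σℤ (λ i → + a i * (x i * y i))

-- α = (1,…,1),  β = -e₁ + e₂  (indices 0-based: e₁ ↦ 0, e₂ ↦ 1)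
α : Fin 10 → ℤ
α _ = + 1

β : Fin 10 → ℤ
β zero = - (+ 1)
β (suc zero) = + 1
β _ = + 0

lvl : ∀ {p n} → (Fin n → ℤ[ p ]) → ℕ → Fin n → ℤ
lvl x k i = at (x i) k

-- x ∈ L_{a,β} ⊗ ℤ_p  (L is saturated in ℤ^10, so L ⊗ ℤ_p is the kernel of the
-- two linear forms B_a(α,-), B_a(β,-) on ℤ_p^10)
InLp : (p : ℕ) → (Fin 10 → ℕ) → (Fin 10 → ℤ[ p ]) → Set
InLp p a x = ∀ k → (Bℤ a α (lvl x k) ≡ + 0 [mod p ℕ.^ k ])
                 × (Bℤ a β (lvl x k) ≡ + 0 [mod p ℕ.^ k ])

EvenUniversal₂ : (Fin 10 → ℕ) → Set
EvenUniversal₂ a = (d : ℤ[ 2 ]) → Σ (Fin 10 → ℤ[ 2 ]) λ x →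
  InLp 2 a x × (∀ k → Qℤ a (lvl x k) ≡ + 2 * at d k [mod 2 ℕ.^ k ])

-- number of odd entries among a₃,…,a₁₀ (0-based indices 2..9)
oddCount : (Fin 10 → ℕ) → ℕ
oddCount a = Σℕ (λ i → if (1 <ᵇ toℕ i) ∧ (a i % 2 ≡ᵇ 1) then 1 else 0)

-- partial sums Σ_{k=1}^{h} a_{j_k}, with j : Fin l → Fin 10 (j_k = j (k-1))
S : ∀ {l} → (Fin 10 → ℕ) → (Fin l → Fin 10) → ℕ → ℕ
S a j h = Σℕ (λ m → if toℕ m <ᵇ h then a (j m) else 0)

σ : ∀ {l} → (Fin 10 → ℕ) → (Fin l → Fin 10) → ℕ
σ {l} a j = S a j l

gcd4 : ℕ → ℕ
gcd4 s = gcd 4 s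

gcd4-nonZero : ∀ s → NonZero (gcd4 s)
gcd4-nonZero s = ≢-nonZero (gcd[m,n]≢0 4 s (inj₁ λ ()))

_/g4[_] : ℕ → ℕ → ℕ
n /g4[ s ] = _/_ n (gcd4 s) {{gcd4-nonZero s}}

sq : ℤ → ℤ
sq x = x * x

b0 : ℕ → ℤ
b0 s = sq (+ ((2 ℕ.* s) /g4[ s ])) + + 2 * sq (+ (s /g4[ s ]))
       + + s * sq (- (+ (4 /g4[ s ])))

bcoef : ∀ {l} → (Fin 10 → ℕ) → (Fin l → Fin 10) → Fin l → ℤ
bcoef a j i with toℕ i
... | zero  = b0 (σ a j)
... | suc h = + (a (j i) ℕ.* S a j (suc h) ℕ.* S a j (suc (suc h)))

diagEntry : ∀ {l} → (Fin l → ℤ) → Fin l → Fin l → ℤ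
diagEntry b i j = if toℕ i ≡ᵇ toℕ j then b i else + 0

-- L_{a,β} ⊗ ℤ_p contains a ℤ_p-sublattice isometric to ⟨b_0⟩ ⊥ … ⊥ ⟨b_{l-1}⟩:
-- there are ℤ_p-linearly independent v_0,…,v_{l-1} ∈ L ⊗ ℤ_p with
-- B_a(v_i, v_j) = δ_ij b_i.
ContainsDiag : (p : ℕ) → (Fin 10 → ℕ) → ∀ {l} → (Fin l → ℤ) → Set
ContainsDiag p a {l} b = Σ (Fin l → Fin 10 → ℤ[ p ]) λ v →
    (∀ i → InLp p a (v i))
  × (∀ i i' k → Bℤ a (lvl (v i) k) (lvl (v i') k) ≡ diagEntry b i i' [mod p ℕ.^ k ])
  × ((c : Fin l → ℤ[ p ]) →
       (∀ k m → Σℤ (λ i → at (c i) k * at (v i m) k) ≡ + 0 [mod p ℕ.^ k ]) →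
       ∀ i k → at (c i) k ≡ + 0 [mod p ℕ.^ k ])

{-# OPTIONS --safe #-}
module Submission where

-- Vectors of ℤ¹⁰ of the form 2t e₁ + t e₂ + Σ_k y_k e_{j_k} are orthogonal to β, pair with α to
-- 4t + Σ_k a_{j_k} y_k and have norm 6t² + Σ_k a_{j_k} y_k². Both parts are therefore computations
-- with the diagonal form ⟨6⟩ ⊥ ⟨a_{j₁}, …, a_{jₗ}⟩ on the hyperplane 4t + Σ_k a_{j_k} y_k = 0.
-- (1) Take odd u = a_p, v = a_q, w = a_r with u ≡ v (mod 4). The line (t, y) = (wz, (w + vz, −uz, −u − 4z))
-- lies in L and has norm 2F(z) with F(z) = A + (1 + 2B) z + 2C z²; the congruence u ≡ v (mod 4) is what
-- makes the z²-coefficient of the norm divisible by 4. As F has odd slope, the Newton iteration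
-- z ↦ z − (F(z) − d) converges 2-adically to a solution of F(z) = d.
-- (2) The vector (t, y) = (σ/g, −4/g, …, −4/g) and the Gram–Schmidt vectors
-- (0, P_h e_h − a_{j_h} Σ_{k<h} e_k), with P_h = Σ_{k<h} a_{j_k}, are pairwise orthogonal with norms
-- b₀, …, b_{l−1}. These norms are nonzero integers and ℤ_p is torsion free, so the vectors are
-- independent over every ℤ_p.

open import Defs
open import Data.Nat using (ℕ; _≤_; _^_)
open import Data.Nat.Primality using (Prime)
open import Data.Integer using (+_)
open import Data.Fin using (Fin; toℕ; zero; suc)
open import Data.Product using (_×_)
open import Function.Definitions using (Injective)
open import Relation.Binary.PropositionalEquality using (_≡_)

open import Data.Bool using (Bool; true; false; if_then_else_; T; _∧_)
import Data.Bool.Properties as Bool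
open import Data.Empty using (⊥-elim)
import Data.Fin.Properties as Fin
open import Data.Fin.Permutation as Perm using (Permutation′; _⟨$⟩ʳ_; _⟨$⟩ˡ_)
open import Data.Integer as ℤ using (ℤ; _+_; _*_; _-_; -_)
import Data.Integer.Properties as ℤ
open import Algebra.Properties.Semiring.Sum ℤ.+-*-semiring
  using (sum; ∑-distrib-+; ∑-comm; *-distribˡ-sum; sum-replicate-zero)
open import Data.Integer.Divisibility.Signed as ℤ∣ using (divides) renaming (_∣_ to _∣ℤ_)
open import Data.Integer.Tactic.RingSolver using (solve-∀)
open import Data.Nat as ℕ using (zero; suc; _≡ᵇ_; _<ᵇ_; _%_; s≤s; z≤n)
import Data.Nat.Properties as ℕ
open import Data.Nat.Divisibility as ℕ∣ using () renaming (_∣_ to _ℕ∣_)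
open import Data.Nat.DivMod using (*-/-assoc; m*[n/m]≡n)
open import Data.Nat.GCD using (gcd[m,n]∣m; gcd[m,n]∣n)
open import Data.Nat.GeneralisedArithmetic using (fold; fold-+)
open import Data.Nat.Primality using (euclidsLemma; prime⇒nonZero; prime⇒nonTrivial)
open import Data.Product using (∃; _,_; proj₁; proj₂)
open import Data.Sum using (inj₁; inj₂)
open import Data.Vec.Functional using (Vector; _∷_; [])
open import Function using (_∘_; case_of_)
open import Function.Bundles using (Equivalence)
open import Relation.Binary.Definitions using (tri<; tri≈; tri>)
open import Relation.Binary.PropositionalEquality
  using (refl; sym; trans; cong; cong₂; subst; subst₂; _≢_; module ≡-Reasoning)
open import Relation.Nullary using (yes; no; ¬_)

-- Finite sums

Σℤ≡sum : ∀ {n} (f : Fin n → ℤ) → Σℤ f ≡ sum f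
Σℤ≡sum {zero}  f = refl
Σℤ≡sum {suc n} f = cong (λ s → f zero + s) (Σℤ≡sum (f ∘ suc))

Σℤ-cong : ∀ {n} {f g : Fin n → ℤ} → (∀ i → f i ≡ g i) → Σℤ f ≡ Σℤ g
Σℤ-cong {zero}  eq = refl
Σℤ-cong {suc n} eq = cong₂ _+_ (eq zero) (Σℤ-cong (eq ∘ suc))

Σℤ-distrib-+ : ∀ {n} (f g : Fin n → ℤ) → Σℤ (λ i → f i + g i) ≡ Σℤ f + Σℤ g
Σℤ-distrib-+ f g = begin
  Σℤ (λ i → f i + g i) ≡⟨ Σℤ≡sum (λ i → f i + g i) ⟩
  sum (λ i → f i + g i) ≡⟨ ∑-distrib-+ f g ⟩
  sum f + sum g         ≡⟨ cong₂ _+_ (Σℤ≡sum f) (Σℤ≡sum g) ⟨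
  Σℤ f + Σℤ g           ∎
  where open ≡-Reasoning

*-distribˡ-Σℤ : ∀ {n} c (f : Fin n → ℤ) → c * Σℤ f ≡ Σℤ (λ i → c * f i)
*-distribˡ-Σℤ c f = begin
  c * Σℤ f              ≡⟨ cong (c *_) (Σℤ≡sum f) ⟩
  c * sum f             ≡⟨ *-distribˡ-sum c f ⟩
  sum (λ i → c * f i)   ≡⟨ Σℤ≡sum (λ i → c * f i) ⟨
  Σℤ (λ i → c * f i)    ∎
  where open ≡-Reasoning

Σℤ-comm : ∀ {m n} (f : Fin m → Fin n → ℤ) →
          Σℤ (λ i → Σℤ (f i)) ≡ Σℤ (λ k → Σℤ (λ i → f i k))
Σℤ-comm {m} {n} f = begin
  Σℤ (λ i → Σℤ (f i))
    ≡⟨ trans (Σℤ-cong (λ i → Σℤ≡sum (f i))) (Σℤ≡sum (λ i → sum (f i))) ⟩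
  sum (λ i → sum (f i))
    ≡⟨ ∑-comm f ⟩
  sum (λ k → sum (λ i → f i k))
    ≡⟨ trans (Σℤ-cong (λ k → Σℤ≡sum (λ i → f i k))) (Σℤ≡sum (λ k → sum (λ i → f i k))) ⟨
  Σℤ (λ k → Σℤ (λ i → f i k)) ∎
  where open ≡-Reasoning

Σℤ-zero : ∀ {n} {f : Fin n → ℤ} → (∀ i → f i ≡ + 0) → Σℤ f ≡ + 0
Σℤ-zero {n} eq = trans (Σℤ-cong eq) (trans (Σℤ≡sum {n} (λ _ → + 0)) (sum-replicate-zero n))

Σℤ-∣ : ∀ {n} {d} (f : Fin n → ℤ) → (∀ i → d ∣ℤ f i) → d ∣ℤ Σℤ f
Σℤ-∣ {zero}  f d∣f = divides (+ 0) refl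
Σℤ-∣ {suc n} f d∣f = ℤ∣.∣m∣n⇒∣m+n (d∣f zero) (Σℤ-∣ (f ∘ suc) (d∣f ∘ suc))

+Σℕ : ∀ {n} (f : Fin n → ℕ) → + Σℕ f ≡ Σℤ (+_ ∘ f)
+Σℕ {zero}  f = refl
+Σℕ {suc n} f = trans (ℤ.pos-+ (f zero) (Σℕ (f ∘ suc))) (cong (λ t → + f zero + t) (+Σℕ (f ∘ suc)))

+-if : ∀ b x → + (if b then x else 0) ≡ (if b then + 1 else + 0) * + x
+-if true  x = sym (ℤ.*-identityˡ (+ x))
+-if false x = refl

-- Kronecker delta

δ : ∀ {n} → Fin n → Fin n → ℤ
δ i j = if toℕ i ≡ᵇ toℕ j then + 1 else + 0

δ-refl : ∀ {n} (i : Fin n) → δ i i ≡ + 1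
δ-refl i with toℕ i ≡ᵇ toℕ i | ℕ.≡⇒≡ᵇ (toℕ i) (toℕ i) refl
... | true | _ = refl

δ-≢ : ∀ {n} {i j : Fin n} → i ≢ j → δ i j ≡ + 0
δ-≢ {i = i} {j} i≢j with toℕ i ≡ᵇ toℕ j in eq
... | false = refl
... | true  = ⊥-elim (i≢j (Fin.toℕ-injective (ℕ.≡ᵇ⇒≡ (toℕ i) (toℕ j) (subst T (sym eq) _))))

δ-sym : ∀ {n} (i j : Fin n) → δ i j ≡ δ j i
δ-sym i j with i Fin.≟ j
... | yes refl = refl
... | no  i≢j  = trans (δ-≢ i≢j) (sym (δ-≢ (i≢j ∘ sym)))

δ-injective : ∀ {m n} {ι : Fin m → Fin n} → Injective _≡_ _≡_ ι → ∀ i j → δ (ι i) (ι j) ≡ δ i j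
δ-injective {ι = ι} inj i j with i Fin.≟ j
... | yes refl = trans (δ-refl (ι i)) (sym (δ-refl i))
... | no  i≢j  = trans (δ-≢ (i≢j ∘ inj)) (sym (δ-≢ i≢j))

Σℤ-δ : ∀ {n} (p : Fin n) (g : Fin n → ℤ) → Σℤ (λ i → δ p i * g i) ≡ g p
Σℤ-δ zero    g = trans (cong₂ _+_ (ℤ.*-identityˡ (g zero)) (Σℤ-zero (λ i → ℤ.*-zeroˡ (g (suc i)))))
                       (ℤ.+-identityʳ (g zero))
Σℤ-δ (suc p) g = trans (cong (_+ Σℤ (λ i → δ (suc p) (suc i) * g (suc i))) (ℤ.*-zeroˡ (g zero)))
                       (trans (ℤ.+-identityˡ _) (Σℤ-δ p (g ∘ suc)))

diagEntry≡δ* : ∀ {l} (b : Fin l → ℤ) i j → diagEntry b i j ≡ δ i j * b i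
diagEntry≡δ* b i j with toℕ i ≡ᵇ toℕ j
... | true  = sym (ℤ.*-identityˡ (b i))
... | false = refl

diagEntry-self : ∀ {l} (b : Fin l → ℤ) i → diagEntry b i i ≡ b i
diagEntry-self b i = trans (diagEntry≡δ* b i i) (trans (cong (_* b i) (δ-refl i)) (ℤ.*-identityˡ (b i)))

diagEntry-≢ : ∀ {l} (b : Fin l → ℤ) {i j} → i ≢ j → diagEntry b i j ≡ + 0
diagEntry-≢ b {i} i≢j = trans (diagEntry≡δ* b i _) (trans (cong (_* b i) (δ-≢ i≢j)) (ℤ.*-zeroˡ (b i)))

Σℤ-diagEntry : ∀ {l} (b c : Fin l → ℤ) i → Σℤ (λ i′ → c i′ * diagEntry b i′ i) ≡ c i * b i
Σℤ-diagEntry b c i = trans (Σℤ-cong δ-form) (Σℤ-δ i (λ i′ → c i′ * b i′))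
  where
  δ-form : ∀ i′ → c i′ * diagEntry b i′ i ≡ δ i i′ * (c i′ * b i′)
  δ-form i′ = begin
    c i′ * diagEntry b i′ i  ≡⟨ cong (c i′ *_) (diagEntry≡δ* b i′ i) ⟩
    c i′ * (δ i′ i * b i′)   ≡⟨ cong (λ d → c i′ * (d * b i′)) (δ-sym i′ i) ⟩
    c i′ * (δ i i′ * b i′)   ≡⟨ ℤ.*-assoc (c i′) _ _ ⟨
    c i′ * δ i i′ * b i′     ≡⟨ cong (_* b i′) (ℤ.*-comm (c i′) (δ i i′)) ⟩
    δ i i′ * c i′ * b i′     ≡⟨ ℤ.*-assoc (δ i i′) _ _ ⟩
    δ i i′ * (c i′ * b i′)   ∎
    where open ≡-Reasoning

-- Diagonal forms

diagForm : ∀ {n} → Vector ℤ n → Vector ℤ n → Vector ℤ n → ℤ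
diagForm w x y = Σℤ (λ i → w i * (x i * y i))

diagForm-comm : ∀ {n} (w x y : Vector ℤ n) → diagForm w x y ≡ diagForm w y x
diagForm-comm w x y = Σℤ-cong (λ i → cong (w i *_) (ℤ.*-comm (x i) (y i)))

diagForm-constant : ∀ {n} (w : Vector ℤ n) c d → diagForm w (λ _ → c) (λ _ → d) ≡ c * d * Σℤ w
diagForm-constant w c d = trans (Σℤ-cong (λ i → ℤ.*-comm (w i) (c * d))) (sym (*-distribˡ-Σℤ (c * d) w))

diagForm-linearˡ : ∀ {l n} (w : Vector ℤ n) (c : Vector ℤ l) (v : Fin l → Vector ℤ n) y →
  diagForm w (λ m → Σℤ (λ i → c i * v i m)) y ≡ Σℤ (λ i → c i * diagForm w (v i) y)
diagForm-linearˡ {l} w c v y = begin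
  Σℤ (λ m → w m * (Σℤ (λ i → c i * v i m) * y m))
    ≡⟨ Σℤ-cong (λ m → trans (rearrange (w m) (Σℤ (λ i → c i * v i m)) (y m))
                            (*-distribˡ-Σℤ {l} (w m * y m) (λ i → c i * v i m))) ⟩
  Σℤ (λ m → Σℤ (λ i → w m * y m * (c i * v i m)))
    ≡⟨ Σℤ-comm (λ m i → w m * y m * (c i * v i m)) ⟩
  Σℤ (λ i → Σℤ (λ m → w m * y m * (c i * v i m)))
    ≡⟨ Σℤ-cong (λ i → trans (Σℤ-cong (λ m → rearrange′ (w m) (y m) (c i) (v i m)))
                            (sym (*-distribˡ-Σℤ (c i) (λ m → w m * (v i m * y m))))) ⟩
  Σℤ (λ i → c i * diagForm w (v i) y) ∎
  where
  open ≡-Reasoning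
  rearrange : ∀ w s y → w * (s * y) ≡ w * y * s
  rearrange = solve-∀
  rearrange′ : ∀ w y c v → w * y * (c * v) ≡ c * (w * (v * y))
  rearrange′ = solve-∀

diagForm-linearʳ : ∀ {n} (w x y y′ : Vector ℤ n) z →
  diagForm w x (λ m → y m + z * y′ m) ≡ diagForm w x y + z * diagForm w x y′
diagForm-linearʳ {n} w x y y′ z = begin
  Σℤ (λ m → w m * (x m * (y m + z * y′ m)))
    ≡⟨ Σℤ-cong (λ m → expand (w m) (x m) (y m) (y′ m) z) ⟩
  Σℤ (λ m → w m * (x m * y m) + z * (w m * (x m * y′ m)))
    ≡⟨ Σℤ-distrib-+ {n} _ _ ⟩
  diagForm w x y + Σℤ (λ m → z * (w m * (x m * y′ m)))
    ≡⟨ cong (λ s → diagForm w x y + s) (sym (*-distribˡ-Σℤ {n} z _)) ⟩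
  diagForm w x y + z * diagForm w x y′ ∎
  where
  open ≡-Reasoning
  expand : ∀ w x y y′ z → w * (x * (y + z * y′)) ≡ w * (x * y) + z * (w * (x * y′))
  expand = solve-∀

diagForm-line : ∀ {n} (w x y : Vector ℤ n) z →
  diagForm w (λ m → x m + z * y m) (λ m → x m + z * y m)
    ≡ diagForm w x x + + 2 * z * diagForm w x y + z * z * diagForm w y y
diagForm-line {n} w x y z = begin
  Σℤ (λ m → w m * ((x m + z * y m) * (x m + z * y m)))
    ≡⟨ Σℤ-cong (λ m → expand (w m) (x m) (y m) z) ⟩
  Σℤ (λ m → (w m * (x m * x m) + + 2 * z * (w m * (x m * y m))) + z * z * (w m * (y m * y m)))
    ≡⟨ Σℤ-distrib-+ {n} _ _ ⟩
  Σℤ (λ m → w m * (x m * x m) + + 2 * z * (w m * (x m * y m))) + Σℤ (λ m → z * z * (w m * (y m * y m)))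
    ≡⟨ cong₂ _+_ (Σℤ-distrib-+ {n} _ _) (sym (*-distribˡ-Σℤ {n} (z * z) _)) ⟩
  diagForm w x x + Σℤ (λ m → + 2 * z * (w m * (x m * y m))) + z * z * diagForm w y y
    ≡⟨ cong (λ s → diagForm w x x + s + z * z * diagForm w y y) (sym (*-distribˡ-Σℤ {n} (+ 2 * z) _)) ⟩
  diagForm w x x + + 2 * z * diagForm w x y + z * z * diagForm w y y ∎
  where
  open ≡-Reasoning
  expand : ∀ w x y z → w * ((x + z * y) * (x + z * y))
                       ≡ (w * (x * x) + + 2 * z * (w * (x * y))) + z * z * (w * (y * y))
  expand = solve-∀

spread : ∀ {m n} → (Fin m → Fin n) → Vector ℤ m → Vector ℤ n
spread ι c x = Σℤ (λ k → c k * δ (ι k) x)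

diagForm-spreadʳ : ∀ {m n} (ι : Fin m → Fin n) (w y : Vector ℤ n) (c : Vector ℤ m) →
  diagForm w y (spread ι c) ≡ diagForm (w ∘ ι) (y ∘ ι) c
diagForm-spreadʳ {m} ι w y c = begin
  Σℤ (λ x → w x * (y x * Σℤ (λ k → c k * δ (ι k) x)))
    ≡⟨ Σℤ-cong (λ x → trans (rearrange (w x) (y x) (spread ι c x)) (*-distribˡ-Σℤ {m} (w x * y x) _)) ⟩
  Σℤ (λ x → Σℤ (λ k → w x * y x * (c k * δ (ι k) x)))
    ≡⟨ Σℤ-comm (λ x k → w x * y x * (c k * δ (ι k) x)) ⟩
  Σℤ (λ k → Σℤ (λ x → w x * y x * (c k * δ (ι k) x)))
    ≡⟨ Σℤ-cong (λ k → trans (Σℤ-cong (λ x → rearrange′ (w x * y x) (c k) (δ (ι k) x)))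
                            (trans (sym (*-distribˡ-Σℤ (c k) (λ x → δ (ι k) x * (w x * y x))))
                                   (cong (c k *_) (Σℤ-δ (ι k) (λ x → w x * y x))))) ⟩
  Σℤ (λ k → c k * (w (ι k) * y (ι k)))
    ≡⟨ Σℤ-cong (λ k → rearrange″ (c k) (w (ι k)) (y (ι k))) ⟩
  diagForm (w ∘ ι) (y ∘ ι) c ∎
  where
  open ≡-Reasoning
  rearrange : ∀ w y s → w * (y * s) ≡ w * y * s
  rearrange = solve-∀
  rearrange′ : ∀ g c d → g * (c * d) ≡ c * (d * g)
  rearrange′ = solve-∀
  rearrange″ : ∀ c w y → c * (w * y) ≡ w * (y * c)
  rearrange″ = solve-∀

spread-∘ : ∀ {m n} {ι : Fin m → Fin n} → Injective _≡_ _≡_ ι → ∀ c k → spread ι c (ι k) ≡ c k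
spread-∘ {ι = ι} inj c k = begin
  Σℤ (λ k′ → c k′ * δ (ι k′) (ι k)) ≡⟨ Σℤ-cong (λ k′ → δ-swap k′) ⟩
  Σℤ (λ k′ → δ k k′ * c k′)         ≡⟨ Σℤ-δ k c ⟩
  c k                               ∎
  where
  open ≡-Reasoning
  δ-swap : ∀ k′ → c k′ * δ (ι k′) (ι k) ≡ δ k k′ * c k′
  δ-swap k′ = trans (ℤ.*-comm (c k′) _) (cong (_* c k′) (trans (δ-injective inj k′ k) (δ-sym k′ k)))

diagForm-spread : ∀ {m n} {ι : Fin m → Fin n} → Injective _≡_ _≡_ ι → ∀ w c c′ →
  diagForm w (spread ι c) (spread ι c′) ≡ diagForm (w ∘ ι) c c′
diagForm-spread {ι = ι} inj w c c′ =
  trans (diagForm-spreadʳ ι w (spread ι c) c′)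
        (Σℤ-cong (λ k → cong (λ x → w (ι k) * (x * c′ k)) (spread-∘ inj c k)))

-- Gram–Schmidt vectors of a diagonal form

below : ∀ {l} → ℕ → Fin l → ℤ
below n k = if toℕ k <ᵇ n then + 1 else + 0

prefix : ∀ {l} → Vector ℤ l → ℕ → ℤ
prefix s n = Σℤ (λ k → below n k * s k)

below-suc : ∀ m n → (if m <ᵇ suc n then + 1 else + 0)
                    ≡ (if m <ᵇ n then + 1 else + 0) + (if n ≡ᵇ m then + 1 else + 0)
below-suc zero    zero    = refl
below-suc zero    (suc n) = refl
below-suc (suc m) zero    = refl
below-suc (suc m) (suc n) = below-suc m n

below-self : ∀ {l} (i : Fin l) → below (toℕ i) i ≡ + 0
below-self i with toℕ i <ᵇ toℕ i in eq
... | false = refl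
... | true  = ⊥-elim (ℕ.<-irrefl refl (ℕ.<ᵇ⇒< (toℕ i) (toℕ i) (subst T (sym eq) _)))

prefix-suc : ∀ {l} (s : Vector ℤ l) i → prefix s (suc (toℕ i)) ≡ prefix s (toℕ i) + s i
prefix-suc s i = begin
  Σℤ (λ k → below (suc (toℕ i)) k * s k)
    ≡⟨ Σℤ-cong (λ k → trans (cong (_* s k) (below-suc (toℕ k) (toℕ i)))
                            (ℤ.*-distribʳ-+ (s k) (below (toℕ i) k) (δ i k))) ⟩
  Σℤ (λ k → below (toℕ i) k * s k + δ i k * s k)
    ≡⟨ Σℤ-distrib-+ (λ k → below (toℕ i) k * s k) (λ k → δ i k * s k) ⟩
  prefix s (toℕ i) + Σℤ (λ k → δ i k * s k)
    ≡⟨ cong (λ t → prefix s (toℕ i) + t) (Σℤ-δ i s) ⟩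
  prefix s (toℕ i) + s i ∎
  where open ≡-Reasoning

prefix-all : ∀ {l} (s : Vector ℤ l) → prefix s l ≡ Σℤ s
prefix-all {l} s = Σℤ-cong below-l
  where
  below-l : ∀ k → below l k * s k ≡ s k
  below-l k with toℕ k <ᵇ l | ℕ.<⇒<ᵇ (Fin.toℕ<n k)
  ... | true | _ = ℤ.*-identityˡ (s k)

below-Σ-const : ∀ {l} (s y : Vector ℤ l) n c → (∀ k → toℕ k ℕ.< n → y k ≡ c) →
                Σℤ (λ k → below n k * (s k * y k)) ≡ c * prefix s n
below-Σ-const s y n c y≡c = trans (Σℤ-cong pull-out) (sym (*-distribˡ-Σℤ c (λ k → below n k * s k)))
  where
  pull-out : ∀ k → below n k * (s k * y k) ≡ c * (below n k * s k)
  pull-out k with toℕ k <ᵇ n in eq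
  ... | true  = trans (cong (λ t → + 1 * (s k * t)) (y≡c k (ℕ.<ᵇ⇒< (toℕ k) n (subst T (sym eq) _))))
                      (one c (s k))
    where
    one : ∀ c s → + 1 * (s * c) ≡ c * (+ 1 * s)
    one = solve-∀
  ... | false = sym (ℤ.*-zeroʳ c)

gramSchmidt : ∀ {l} → Vector ℤ l → Fin l → Vector ℤ l
gramSchmidt s i k = prefix s (toℕ i) * δ i k - s i * below (toℕ i) k

gramSchmidt-pairing : ∀ {l} (s y : Vector ℤ l) i →
  diagForm s (gramSchmidt s i) y
    ≡ prefix s (toℕ i) * (s i * y i) - s i * Σℤ (λ k → below (toℕ i) k * (s k * y k))
gramSchmidt-pairing s y i = begin
  Σℤ (λ k → s k * ((P * δ i k - s i * below (toℕ i) k) * y k))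
    ≡⟨ Σℤ-cong (λ k → expand (s k) P (δ i k) (s i) (below (toℕ i) k) (y k)) ⟩
  Σℤ (λ k → P * (δ i k * (s k * y k)) + - s i * (below (toℕ i) k * (s k * y k)))
    ≡⟨ Σℤ-distrib-+ (λ k → P * (δ i k * (s k * y k))) (λ k → - s i * (below (toℕ i) k * (s k * y k))) ⟩
  Σℤ (λ k → P * (δ i k * (s k * y k))) + Σℤ (λ k → - s i * (below (toℕ i) k * (s k * y k)))
    ≡⟨ cong₂ _+_ (sym (*-distribˡ-Σℤ P (λ k → δ i k * (s k * y k))))
                 (sym (*-distribˡ-Σℤ (- s i) (λ k → below (toℕ i) k * (s k * y k)))) ⟩
  P * Σℤ (λ k → δ i k * (s k * y k)) + - s i * Σℤ (λ k → below (toℕ i) k * (s k * y k))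
    ≡⟨ cong₂ (λ u v → P * u + v) (Σℤ-δ i (λ k → s k * y k)) (sym (ℤ.neg-distribˡ-* (s i) _)) ⟩
  P * (s i * y i) - s i * Σℤ (λ k → below (toℕ i) k * (s k * y k)) ∎
  where
  open ≡-Reasoning
  P = prefix s (toℕ i)
  expand : ∀ s P d sᵢ b y → s * ((P * d - sᵢ * b) * y) ≡ P * (d * (s * y)) + - sᵢ * (b * (s * y))
  expand = solve-∀

gramSchmidt-below : ∀ {l} (s : Vector ℤ l) {i k} → toℕ k ℕ.< toℕ i → gramSchmidt s i k ≡ - s i
gramSchmidt-below s {i} {k} k<i with toℕ k <ᵇ toℕ i | ℕ.<⇒<ᵇ k<i
... | true | _ = trans (cong (λ d → prefix s (toℕ i) * d - s i * + 1) (δ-≢ i≢k))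
                      (simplify (prefix s (toℕ i)) (s i))
  where
  i≢k : i ≢ k
  i≢k refl = ℕ.<-irrefl refl k<i
  simplify : ∀ P sᵢ → P * + 0 - sᵢ * + 1 ≡ - sᵢ
  simplify = solve-∀

gramSchmidt-self : ∀ {l} (s : Vector ℤ l) i → gramSchmidt s i i ≡ prefix s (toℕ i)
gramSchmidt-self s i = trans (cong₂ (λ d b → prefix s (toℕ i) * d - s i * b) (δ-refl i) (below-self i))
                              (simplify (prefix s (toℕ i)) (s i))
  where
  simplify : ∀ P sᵢ → P * + 1 - sᵢ * + 0 ≡ P
  simplify = solve-∀

gramSchmidt-orthogonal : ∀ {l} (s y : Vector ℤ l) i c → (∀ k → toℕ k ℕ.≤ toℕ i → y k ≡ c) →
                         diagForm s (gramSchmidt s i) y ≡ + 0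
gramSchmidt-orthogonal s y i c y≡c = begin
  diagForm s (gramSchmidt s i) y
    ≡⟨ gramSchmidt-pairing s y i ⟩
  P * (s i * y i) - s i * Σℤ (λ k → below (toℕ i) k * (s k * y k))
    ≡⟨ cong₂ (λ yᵢ Σ → P * (s i * yᵢ) - s i * Σ) (y≡c i ℕ.≤-refl)
             (below-Σ-const s y (toℕ i) c (λ k k<i → y≡c k (ℕ.<⇒≤ k<i))) ⟩
  P * (s i * c) - s i * (c * P)
    ≡⟨ cancel P (s i) c ⟩
  + 0 ∎
  where
  open ≡-Reasoning
  P = prefix s (toℕ i)
  cancel : ∀ P sᵢ c → P * (sᵢ * c) - sᵢ * (c * P) ≡ + 0
  cancel = solve-∀

gramSchmidt-norm : ∀ {l} (s : Vector ℤ l) i →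
                   diagForm s (gramSchmidt s i) (gramSchmidt s i) ≡ s i * prefix s (toℕ i) * prefix s (suc (toℕ i))
gramSchmidt-norm s i = begin
  diagForm s (gramSchmidt s i) (gramSchmidt s i)
    ≡⟨ gramSchmidt-pairing s (gramSchmidt s i) i ⟩
  P * (s i * gramSchmidt s i i) - s i * Σℤ (λ k → below (toℕ i) k * (s k * gramSchmidt s i k))
    ≡⟨ cong₂ (λ gᵢ Σ → P * (s i * gᵢ) - s i * Σ) (gramSchmidt-self s i)
             (below-Σ-const s (gramSchmidt s i) (toℕ i) (- s i) (λ k → gramSchmidt-below s)) ⟩
  P * (s i * P) - s i * (- s i * P)
    ≡⟨ factor P (s i) ⟩
  s i * P * (P + s i)
    ≡⟨ cong (s i * P *_) (sym (prefix-suc s i)) ⟩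
  s i * P * prefix s (suc (toℕ i)) ∎
  where
  open ≡-Reasoning
  P = prefix s (toℕ i)
  factor : ∀ P sᵢ → P * (sᵢ * P) - sᵢ * (- sᵢ * P) ≡ sᵢ * P * (P + sᵢ)
  factor = solve-∀

-- Congruences and p-adic integers

∣-respʳ : ∀ {k x y} → x ≡ y → k ∣ℤ x → k ∣ℤ y
∣-respʳ refl k∣x = k∣x

[mod]⇒∣ : ∀ x y {m} → x ≡ y [mod m ] → + m ∣ℤ x - y
[mod]⇒∣ x y {m} = ℤ∣.∣ᵤ⇒∣ {+ m} {x - y}

∣⇒[mod] : ∀ x y {m} → + m ∣ℤ x - y → x ≡ y [mod m ]
∣⇒[mod] x y {m} = ℤ∣.∣⇒∣ᵤ {+ m} {x - y}

∣-refl-− : ∀ {k} x → k ∣ℤ x - x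
∣-refl-− {k} x = divides (+ 0) (trans (ℤ.+-inverseʳ x) (sym (ℤ.*-zeroˡ k)))

≡⇒≡[mod] : ∀ {x y : ℤ} {m} → x ≡ y → x ≡ y [mod m ]
≡⇒≡[mod] {x} {m = m} refl = ∣⇒[mod] x x (∣-refl-− {+ m} x)

+pow-suc : ∀ p n → + (p ^ suc n) ≡ + p * + (p ^ n)
+pow-suc p n = ℤ.pos-* p (p ^ n)

pow-∣-pow-suc : ∀ p n → + (p ^ n) ∣ℤ + (p ^ suc n)
pow-∣-pow-suc p n = divides (+ p) (+pow-suc p n)

pow-∣-pow-+ : ∀ p n k → + (p ^ k) ∣ℤ + (p ^ (n ℕ.+ k))
pow-∣-pow-+ p n k = ℤ∣.∣ᵤ⇒∣ (subst (p ^ k ℕ∣_) (sym (ℕ.^-distribˡ-+-* p n k)) (ℕ∣.n∣m*n (p ^ n)))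

fromℤ : ∀ {p} → ℤ → ℤ[ p ]
fromℤ x = record { at = λ _ → x ; coh = λ k → ≡⇒≡[mod] {x} refl }

affine : ∀ {p} → ℤ → ℤ → ℤ[ p ] → ℤ[ p ]
affine {p} c₀ c₁ z = record { at = λ k → c₀ + at z k * c₁ ; coh = coh′ }
  where
  coh′ : ∀ k → (c₀ + at z (suc k) * c₁) ≡ (c₀ + at z k * c₁) [mod p ^ k ]
  coh′ k = ∣⇒[mod] (c₀ + at z (suc k) * c₁) (c₀ + at z k * c₁)
             (∣-respʳ (difference c₀ c₁ (at z (suc k)) (at z k))
               (ℤ∣.∣m⇒∣m*n c₁ ([mod]⇒∣ (at z (suc k)) (at z k) (coh z k))))
    where
    difference : ∀ c₀ c₁ z′ z → (z′ - z) * c₁ ≡ (c₀ + z′ * c₁) - (c₀ + z * c₁)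
    difference = solve-∀

coh-+ : ∀ {p} (c : ℤ[ p ]) N k → + (p ^ k) ∣ℤ at c (N ℕ.+ k) - at c k
coh-+ c zero    k = ∣-refl-− (at c k)
coh-+ {p} c (suc N) k =
  ∣-respʳ (telescope (at c (suc N ℕ.+ k)) (at c (N ℕ.+ k)) (at c k))
    (ℤ∣.∣m∣n⇒∣m+n (ℤ∣.∣-trans (pow-∣-pow-+ p N k)
                               ([mod]⇒∣ (at c (suc N ℕ.+ k)) (at c (N ℕ.+ k)) (coh c (N ℕ.+ k))))
                  (coh-+ c N k))
  where
  telescope : ∀ x y z → (x - y) + (y - z) ≡ x - z
  telescope = solve-∀

module Hensel {p : ℕ} (f : ℤ → ℤ) (slope : ∀ x y → + p * (x - y) ∣ℤ (x - y) - (f x - f y)) where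

  -- Newton's step for f z = d with the derivative replaced by 1; it contracts since f has slope ≡ 1 (mod p).
  step : ℤ → ℤ → ℤ
  step d z = z - (f z - d)

  step-contract : ∀ {m} d d′ X Y → m ∣ℤ d - d′ → m ∣ℤ + p * (X - Y) → m ∣ℤ step d X - step d′ Y
  step-contract d d′ X Y m∣d-d′ m∣p[X-Y] =
    ∣-respʳ (sym (step-difference d d′ X Y (f X) (f Y)))
      (ℤ∣.∣m∣n⇒∣m+n m∣d-d′ (ℤ∣.∣-trans m∣p[X-Y] (slope X Y)))
    where
    step-difference : ∀ d d′ X Y fX fY →
      (X - (fX - d)) - (Y - (fY - d′)) ≡ (d - d′) + ((X - Y) - (fX - fY))
    step-difference = solve-∀

  Contracting : ℕ → Set
  Contracting n = ∀ {d d′} x y → + (p ^ n) ∣ℤ d - d′ →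
                  + (p ^ n) ∣ℤ fold x (step d) n - fold y (step d′) n

  contracting-suc : ∀ n → Contracting n → Contracting (suc n)
  contracting-suc n ih {d} {d′} x y pⁿ⁺¹∣d-d′ =
    step-contract {+ (p ^ suc n)} d d′ (fold x (step d) n) (fold y (step d′) n) pⁿ⁺¹∣d-d′
      (subst (_∣ℤ + p * (fold x (step d) n - fold y (step d′) n)) (sym (+pow-suc p n))
        (ℤ∣.*-monoʳ-∣ (+ p) (ih x y (ℤ∣.∣-trans (pow-∣-pow-suc p n) pⁿ⁺¹∣d-d′))))

  contracting : ∀ n → Contracting n
  contracting zero    x y _ = divides (x - y) (sym (ℤ.*-identityʳ (x - y)))
  contracting (suc n) = contracting-suc n (contracting n)

  approx : ℤ → ℕ → ℤ
  approx d = fold (+ 0) (step d)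

  fold-step : ∀ d k → fold (step d (+ 0)) (step d) k ≡ step d (approx d k)
  fold-step d k = trans (sym (fold-+ (+ 0) (step d) k {1})) (cong (fold (+ 0) (step d)) (ℕ.+-comm k 1))

  approx-root : ∀ d k → + (p ^ k) ∣ℤ f (approx d k) - d
  approx-root d k = ∣-respʳ (residual d (approx d k) (f (approx d k)))
    (ℤ∣.∣m⇒∣-m (∣-respʳ (cong (_- approx d k) (fold-step d k))
                  (contracting k (step d (+ 0)) (+ 0) (∣-refl-− d))))
    where
    residual : ∀ d A fA → - ((A - (fA - d)) - A) ≡ fA - d
    residual = solve-∀

  approx-coh : ∀ (d : ℤ[ p ]) k → + (p ^ k) ∣ℤ approx (at d (suc k)) (suc k) - approx (at d k) k
  approx-coh d k = ∣-respʳ (cong (_- approx (at d k) k) (fold-step (at d (suc k)) k))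
    (contracting k (step (at d (suc k)) (+ 0)) (+ 0) ([mod]⇒∣ (at d (suc k)) (at d k) (coh d k)))

  root : ℤ[ p ] → ℤ[ p ]
  root d = record
    { at  = λ k → approx (at d k) k
    ; coh = λ k → ∣⇒[mod] (approx (at d (suc k)) (suc k)) (approx (at d k) k) (approx-coh d k)
    }

  root-correct : ∀ d k → f (at (root d) k) ≡ at d k [mod p ^ k ]
  root-correct d k = ∣⇒[mod] (f (approx (at d k) k)) (at d k) (approx-root (at d k) k)

n<m^n : ∀ {m} → 1 ℕ.< m → ∀ n → n ℕ.< m ^ n
n<m^n 1<m zero    = s≤s z≤n
n<m^n 1<m (suc n) = ℕ.≤-<-trans (n<m^n 1<m n) (ℕ.^-monoʳ-< _ 1<m (ℕ.n<1+n n))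

prime^-∣-*-cancel : ∀ {p} → Prime p → ∀ k N {x y} →
                    p ^ (k ℕ.+ N) ℕ∣ x ℕ.* y → ¬ (p ^ N ℕ∣ y) → p ^ k ℕ∣ x
prime^-∣-*-cancel pr zero N _ _ = ℕ∣.1∣ _
prime^-∣-*-cancel {p} pr (suc k) N {x} {y} pᵏ⁺ᴺ∣xy pᴺ∤y
  with euclidsLemma x y pr (ℕ∣.∣-trans (ℕ∣.m∣m*n (p ^ (k ℕ.+ N))) pᵏ⁺ᴺ∣xy)
... | inj₁ (ℕ∣.divides x′ refl) =
  subst (p ^ suc k ℕ∣_) (ℕ.*-comm p x′)
    (ℕ∣.*-monoʳ-∣ p (prime^-∣-*-cancel pr k N pᵏ⁺ᴺ∣x′y pᴺ∤y))
  where
  instance _ = prime⇒nonZero pr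
  pᵏ⁺ᴺ∣x′y : p ^ (k ℕ.+ N) ℕ∣ x′ ℕ.* y
  pᵏ⁺ᴺ∣x′y = ℕ∣.*-cancelˡ-∣ p (subst (p ^ suc (k ℕ.+ N) ℕ∣_)
                 (trans (cong (ℕ._* y) (ℕ.*-comm x′ p)) (ℕ.*-assoc p x′ y)) pᵏ⁺ᴺ∣xy)
prime^-∣-*-cancel pr (suc k) zero _ pᴺ∤y | inj₂ _ = ⊥-elim (pᴺ∤y (ℕ∣.1∣ _))
prime^-∣-*-cancel {p} pr (suc k) (suc N) {x} pᵏ⁺ᴺ∣xy pᴺ∤y | inj₂ (ℕ∣.divides y′ refl) =
  prime^-∣-*-cancel pr (suc k) N pᵏ⁺ᴺ∣xy′ pᴺ∤y′
  where
  instance _ = prime⇒nonZero pr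
  pᵏ⁺ᴺ∣xy′ : p ^ (suc k ℕ.+ N) ℕ∣ x ℕ.* y′
  pᵏ⁺ᴺ∣xy′ = ℕ∣.*-cancelˡ-∣ p (subst₂ _ℕ∣_ (cong (p ^_) (ℕ.+-suc (suc k) N))
                 (trans (sym (ℕ.*-assoc x y′ p)) (ℕ.*-comm (x ℕ.* y′) p)) pᵏ⁺ᴺ∣xy)
  pᴺ∤y′ : ¬ (p ^ N ℕ∣ y′)
  pᴺ∤y′ pᴺ∣y′ = pᴺ∤y (subst (λ t → t ℕ∣ y′ ℕ.* p) (ℕ.*-comm (p ^ N) p)
                            (ℕ∣.*-monoˡ-∣ p pᴺ∣y′))

-- With N = ∣ b ∣ we have p ^ N ∤ b, so p ^ (k + N) ∣ c_(N+k) b forces p ^ k ∣ c_(N+k) ≡ c_k.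
ℤ[p]-cancel : ∀ {p} → Prime p → ∀ {b} → b ≢ + 0 → (c : ℤ[ p ]) →
              (∀ k → (at c k * b) ≡ + 0 [mod p ^ k ]) → ∀ k → at c k ≡ + 0 [mod p ^ k ]
ℤ[p]-cancel {p} pr {b} b≢0 c cb≡0 k =
  ∣⇒[mod] (at c k) (+ 0) (∣-respʳ (sym (ℤ.+-identityʳ (at c k)))
    (∣-respʳ (shift (at c (N ℕ.+ k)) (at c k)) (ℤ∣.∣m∣n⇒∣m-n pᵏ∣c[N+k] (coh-+ c N k))))
  where
  N = ℤ.∣ b ∣
  instance _ = ℕ.≢-nonZero (b≢0 ∘ ℤ.∣i∣≡0⇒i≡0)
  pᴺ∤N : ¬ (p ^ N ℕ∣ N)
  pᴺ∤N pᴺ∣N = ℕ.<⇒≱ (n<m^n (ℕ.nonTrivial⇒n>1 p {{prime⇒nonTrivial pr}}) N) (ℕ∣.∣⇒≤ pᴺ∣N)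
  pᵏ⁺ᴺ∣cN : p ^ (k ℕ.+ N) ℕ∣ ℤ.∣ at c (N ℕ.+ k) ∣ ℕ.* N
  pᵏ⁺ᴺ∣cN = subst₂ _ℕ∣_ (cong (p ^_) (ℕ.+-comm N k))
              (trans (cong ℤ.∣_∣ (ℤ.+-identityʳ (at c (N ℕ.+ k) * b))) (ℤ.abs-* (at c (N ℕ.+ k)) b))
              (cb≡0 (N ℕ.+ k))
  pᵏ∣c[N+k] : + (p ^ k) ∣ℤ at c (N ℕ.+ k)
  pᵏ∣c[N+k] = ℤ∣.∣ᵤ⇒∣ {+ (p ^ k)} {at c (N ℕ.+ k)} (prime^-∣-*-cancel pr k N pᵏ⁺ᴺ∣cN pᴺ∤N)
  shift : ∀ x y → x - (x - y) ≡ y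
  shift = solve-∀

-- Choosing indices

Fin0-injective : ∀ {n} {f : Fin 0 → Fin n} → Injective _≡_ _≡_ f
Fin0-injective {x = ()}

select : ∀ {n} (g : Fin n → Bool) k → k ≤ Σℕ (λ i → if g i then 1 else 0) →
         ∃ λ (f : Fin k → Fin n) → Injective _≡_ _≡_ f × (∀ i → T (g (f i)))
select g zero _ = (λ ()) , Fin0-injective , λ ()
select {suc n} g (suc k) k≤count with g zero in g₀
... | true  with select (g ∘ suc) k (ℕ.≤-pred k≤count)
...   | f , f-inj , f-ok = (zero ∷ suc ∘ f) , cons-injective , cons-ok
  where
  cons-injective : Injective _≡_ _≡_ (zero ∷ suc ∘ f)
  cons-injective {zero}  {zero}  _  = refl
  cons-injective {suc i} {suc i′} eq = cong suc (f-inj (Fin.suc-injective eq))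
  cons-ok : ∀ i → T (g ((zero ∷ suc ∘ f) i))
  cons-ok zero    = subst T (sym g₀) _
  cons-ok (suc i) = f-ok i
select {suc n} g (suc k) k≤count | false with select (g ∘ suc) (suc k) k≤count
...   | f , f-inj , f-ok = suc ∘ f , f-inj ∘ Fin.suc-injective , f-ok

perm-injective : ∀ {n} (π : Permutation′ n) → Injective _≡_ _≡_ (π ⟨$⟩ʳ_)
perm-injective π eq = trans (sym (Perm.inverseˡ π)) (trans (cong (π ⟨$⟩ˡ_) eq) (Perm.inverseˡ π))

≢∧≢⇒≡ : ∀ {x y z : Bool} → x ≢ y → x ≢ z → y ≡ z
≢∧≢⇒≡ {false} {false} x≢y _   = ⊥-elim (x≢y refl)
≢∧≢⇒≡ {true}  {true}  x≢y _   = ⊥-elim (x≢y refl)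
≢∧≢⇒≡ {false} {true}  {false} _ x≢z = ⊥-elim (x≢z refl)
≢∧≢⇒≡ {false} {true}  {true}  _ _   = refl
≢∧≢⇒≡ {true}  {false} {false} _ _   = refl
≢∧≢⇒≡ {true}  {false} {true}  _ x≢z = ⊥-elim (x≢z refl)

agreeing-pair : (b : Fin 3 → Bool) →
                ∃ λ (π : Permutation′ 3) → b (π ⟨$⟩ʳ zero) ≡ b (π ⟨$⟩ʳ suc zero)
agreeing-pair b with b zero Bool.≟ b (suc zero) | b zero Bool.≟ b (suc (suc zero))
... | yes b₀≡b₁ | _         = Perm.id , b₀≡b₁
... | no _      | yes b₀≡b₂ = Perm.transpose (suc zero) (suc (suc zero)) , b₀≡b₂
... | no b₀≢b₁  | no b₀≢b₂  = Perm.transpose zero (suc (suc zero)) , sym (≢∧≢⇒≡ b₀≢b₁ b₀≢b₂)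

bit : Bool → ℤ
bit b = if b then + 1 else + 0

odd-form : ∀ n → T (n % 2 ≡ᵇ 1) → ∃ λ m → ∃ λ b → + n ≡ + 4 * m + (+ 2 * bit b + + 1)
odd-form 1 _ = + 0 , false , refl
odd-form 3 _ = + 0 , true , refl
odd-form (suc (suc (suc (suc n)))) n-odd with odd-form n n-odd
... | m , b , n≡ = m + + 1 , b , trans (ℤ.pos-+ 4 n) (trans (cong (λ x → + 4 + x) n≡) (shift m (bit b)))
  where
  shift : ∀ m c → + 4 + (+ 4 * m + (+ 2 * c + + 1)) ≡ + 4 * (m + + 1) + (+ 2 * c + + 1)
  shift = solve-∀

-- The lattice L_{a,β}

β-vanishes : ∀ i → 2 ≤ toℕ i → β i ≡ + 0
β-vanishes (suc (suc i)) _         = refl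
β-vanishes zero          ()
β-vanishes (suc zero)    (s≤s ())

B[α,β]≡1 : ∀ a → a zero ≡ 1 → a (suc zero) ≡ 2 → Bℤ a α β ≡ + 1
B[α,β]≡1 a a₀≡1 a₁≡2 =
  trans (cong (λ t → + a zero * (+ 1 * - + 1) + (+ a (suc zero) * (+ 1 * + 1) + t))
              (Σℤ-zero (λ i → ℤ.*-zeroʳ (+ a (suc (suc i))))))
        (cong₂ (λ a₀ a₁ → + a₀ * (+ 1 * - + 1) + (+ a₁ * (+ 1 * + 1) + + 0)) a₀≡1 a₁≡2)

module Coordinates (a : Fin 10 → ℕ) (a₀≡1 : a zero ≡ 1) (a₁≡2 : a (suc zero) ≡ 2)
                   {l} (j : Fin l → Fin 10) (j-inj : Injective _≡_ _≡_ j) (j≥2 : ∀ k → 2 ≤ toℕ (j k))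
                   where

  s : Vector ℤ l
  s k = + a (j k)

  ι : Fin (2 ℕ.+ l) → Fin 10
  ι = zero ∷ suc zero ∷ j

  private
    j≢0 : ∀ k → j k ≢ zero
    j≢0 k eq with subst (λ i → 2 ≤ toℕ i) eq (j≥2 k)
    ... | ()

    j≢1 : ∀ k → j k ≢ suc zero
    j≢1 k eq with subst (λ i → 2 ≤ toℕ i) eq (j≥2 k)
    ... | s≤s ()

  ι-injective : Injective _≡_ _≡_ ι
  ι-injective {zero}        {zero}         _  = refl
  ι-injective {zero}        {suc zero}     ()
  ι-injective {zero}        {suc (suc k)}  eq = ⊥-elim (j≢0 k (sym eq))
  ι-injective {suc zero}    {zero}         ()
  ι-injective {suc zero}    {suc zero}     _  = refl
  ι-injective {suc zero}    {suc (suc k)}  eq = ⊥-elim (j≢1 k (sym eq))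
  ι-injective {suc (suc k)} {zero}         eq = ⊥-elim (j≢0 k eq)
  ι-injective {suc (suc k)} {suc zero}     eq = ⊥-elim (j≢1 k eq)
  ι-injective {suc (suc k)} {suc (suc k′)} eq = cong (λ i → suc (suc i)) (j-inj eq)

  ι-weights : ∀ x y → diagForm (+_ ∘ a ∘ ι) x y ≡ diagForm (+ 1 ∷ + 2 ∷ s) x y
  ι-weights x y = cong₂ (λ a₀ a₁ → + a₀ * (x zero * y zero) + (+ a₁ * (x (suc zero) * y (suc zero))
                                    + diagForm s (λ k → x (suc (suc k))) (λ k → y (suc (suc k)))))
                        a₀≡1 a₁≡2

  lift : ℤ → Vector ℤ l → Fin 10 → ℤ
  lift t y = spread ι (+ 2 * t ∷ t ∷ y)

  lift-α : ∀ t y → Bℤ a α (lift t y) ≡ + 4 * t + diagForm s (λ _ → + 1) y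
  lift-α t y = trans (diagForm-spreadʳ ι (+_ ∘ a) α (+ 2 * t ∷ t ∷ y))
                     (trans (ι-weights (λ _ → + 1) (+ 2 * t ∷ t ∷ y)) (collect t (diagForm s (λ _ → + 1) y)))
    where
    collect : ∀ t D → + 1 * (+ 1 * (+ 2 * t)) + (+ 2 * (+ 1 * t) + D) ≡ + 4 * t + D
    collect = solve-∀

  lift-β : ∀ t y → Bℤ a β (lift t y) ≡ + 0
  lift-β t y = begin
    Bℤ a β (lift t y)
      ≡⟨ trans (diagForm-spreadʳ ι (+_ ∘ a) β (+ 2 * t ∷ t ∷ y))
               (ι-weights (β ∘ ι) (+ 2 * t ∷ t ∷ y)) ⟩
    + 1 * (- + 1 * (+ 2 * t)) + (+ 2 * (+ 1 * t) + diagForm s (β ∘ j) y)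
      ≡⟨ cong (λ D → + 1 * (- + 1 * (+ 2 * t)) + (+ 2 * (+ 1 * t) + D)) (Σℤ-zero β∘j-vanishes) ⟩
    + 1 * (- + 1 * (+ 2 * t)) + (+ 2 * (+ 1 * t) + + 0)
      ≡⟨ cancel t ⟩
    + 0 ∎
    where
    open ≡-Reasoning
    β∘j-vanishes : ∀ k → s k * (β (j k) * y k) ≡ + 0
    β∘j-vanishes k = trans (cong (λ b → s k * (b * y k)) (β-vanishes (j k) (j≥2 k))) (ℤ.*-zeroʳ (s k))
    cancel : ∀ t → + 1 * (- + 1 * (+ 2 * t)) + (+ 2 * (+ 1 * t) + + 0) ≡ + 0
    cancel = solve-∀

  lift-B : ∀ t y t′ y′ → Bℤ a (lift t y) (lift t′ y′) ≡ + 6 * (t * t′) + diagForm s y y′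
  lift-B t y t′ y′ =
    trans (diagForm-spread ι-injective (+_ ∘ a) (+ 2 * t ∷ t ∷ y) (+ 2 * t′ ∷ t′ ∷ y′))
          (trans (ι-weights (+ 2 * t ∷ t ∷ y) (+ 2 * t′ ∷ t′ ∷ y′)) (collect t t′ (diagForm s y y′)))
    where
    collect : ∀ t t′ D → + 1 * (+ 2 * t * (+ 2 * t′)) + (+ 2 * (t * t′) + D) ≡ + 6 * (t * t′) + D
    collect = solve-∀

integral⇒ContainsDiag : ∀ {p} → Prime p → (a : Fin 10 → ℕ) →
  ∀ {l} (b : Fin l → ℤ) (V : Fin l → Fin 10 → ℤ) →
  (∀ i → Bℤ a α (V i) ≡ + 0) → (∀ i → Bℤ a β (V i) ≡ + 0) →
  (∀ i i′ → Bℤ a (V i) (V i′) ≡ diagEntry b i i′) → (∀ i → b i ≢ + 0) →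
  ContainsDiag p a b
integral⇒ContainsDiag {p} pr a {l} b V V⊥α V⊥β gram b≢0 =
    v
  , (λ i k → ≡⇒≡[mod] (V⊥α i) , ≡⇒≡[mod] (V⊥β i))
  , (λ i i′ k → ≡⇒≡[mod] (gram i i′))
  , independent
  where
  v : Fin l → Fin 10 → ℤ[ p ]
  v i m = fromℤ (V i m)
  independent : (c : Fin l → ℤ[ p ]) →
    (∀ k m → Σℤ (λ i → at (c i) k * V i m) ≡ + 0 [mod p ^ k ]) → ∀ i k → at (c i) k ≡ + 0 [mod p ^ k ]
  independent c Σcv≡0 i = ℤ[p]-cancel pr (b≢0 i) (c i) cᵢbᵢ≡0
    where
    cᵢbᵢ≡0 : ∀ k → (at (c i) k * b i) ≡ + 0 [mod p ^ k ]
    cᵢbᵢ≡0 k = ∣⇒[mod] (at (c i) k * b i) (+ 0) (∣-respʳ (sym (ℤ.+-identityʳ _))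
                 (∣-respʳ pairing
                   (Σℤ-∣ _ (λ m → ℤ∣.∣n⇒∣m*n (+ a m) (ℤ∣.∣m⇒∣m*n (V i m) (pᵏ∣W m))))))
      where
      W : Fin 10 → ℤ
      W m = Σℤ (λ i′ → at (c i′) k * V i′ m)
      pᵏ∣W : ∀ m → + (p ^ k) ∣ℤ W m
      pᵏ∣W m = ∣-respʳ (ℤ.+-identityʳ (W m)) ([mod]⇒∣ (W m) (+ 0) (Σcv≡0 k m))
      pairing : Bℤ a W (V i) ≡ at (c i) k * b i
      pairing = begin
        Bℤ a W (V i)
          ≡⟨ diagForm-linearˡ (+_ ∘ a) (λ i′ → at (c i′) k) V (V i) ⟩
        Σℤ (λ i′ → at (c i′) k * Bℤ a (V i′) (V i))
          ≡⟨ Σℤ-cong (λ i′ → cong (at (c i′) k *_) (gram i′ i)) ⟩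
        Σℤ (λ i′ → at (c i′) k * diagEntry b i′ i)
          ≡⟨ Σℤ-diagEntry b (λ i′ → at (c i′) k) i ⟩
        at (c i) k * b i ∎
        where open ≡-Reasoning

pos≢0 : ∀ {n} → 1 ≤ n → + n ≢ + 0
pos≢0 (s≤s _) ()

S-suc-pos : ∀ (a : Fin 10 → ℕ) {l} (j : Fin (suc l) → Fin 10) → 1 ≤ a (j zero) → ∀ n → 1 ≤ S a j (suc n)
S-suc-pos a j a₀≥1 n = ℕ.≤-trans a₀≥1 (ℕ.m≤m+n _ _)

module DiagonalSublattice (a : Fin 10 → ℕ) (a≥1 : ∀ i → 1 ≤ a i)
                          (a₀≡1 : a zero ≡ 1) (a₁≡2 : a (suc zero) ≡ 2)
                          {l} (j : Fin l → Fin 10) (j-inj : Injective _≡_ _≡_ j) (j≥2 : ∀ k → 2 ≤ toℕ (j k))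
                          where

  open Coordinates a a₀≡1 a₁≡2 j j-inj j≥2

  +S≡prefix : ∀ n → + S a j n ≡ prefix s n
  +S≡prefix n = trans (+Σℕ (λ k → if toℕ k <ᵇ n then a (j k) else 0))
                      (Σℤ-cong (λ k → +-if (toℕ k <ᵇ n) (a (j k))))

  +σ≡Σs : + σ a j ≡ Σℤ s
  +σ≡Σs = trans (+S≡prefix l) (prefix-all s)

  g q f : ℕ
  g = gcd4 (σ a j)
  q = σ a j /g4[ σ a j ]
  f = 4 /g4[ σ a j ]

  instance
    g≢0 : ℕ.NonZero g
    g≢0 = gcd4-nonZero (σ a j)

  4q≡fσ : 4 ℕ.* q ≡ f ℕ.* σ a j
  4q≡fσ = begin
    4 ℕ.* (σ a j ℕ./ g)   ≡⟨ *-/-assoc 4 (gcd[m,n]∣n 4 (σ a j)) ⟨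
    4 ℕ.* σ a j ℕ./ g     ≡⟨ cong (ℕ._/ g) (ℕ.*-comm 4 (σ a j)) ⟩
    σ a j ℕ.* 4 ℕ./ g     ≡⟨ *-/-assoc (σ a j) (gcd[m,n]∣m 4 (σ a j)) ⟩
    σ a j ℕ.* (4 ℕ./ g)   ≡⟨ ℕ.*-comm (σ a j) f ⟩
    f ℕ.* σ a j           ∎
    where open ≡-Reasoning

  V : Fin l → Fin 10 → ℤ
  V zero    = lift (+ q) (λ _ → - + f)
  V (suc i) = lift (+ 0) (gramSchmidt s (suc i))

  V⊥α : ∀ i → Bℤ a α (V i) ≡ + 0
  V⊥α zero = begin
    Bℤ a α (V zero)
      ≡⟨ lift-α (+ q) (λ _ → - + f) ⟩
    + 4 * + q + diagForm s (λ _ → + 1) (λ _ → - + f)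
      ≡⟨ cong₂ _+_ (sym (ℤ.pos-* 4 q)) (diagForm-constant s (+ 1) (- + f)) ⟩
    + (4 ℕ.* q) + + 1 * - + f * Σℤ s
      ≡⟨ cong₂ (λ x σ′ → + x + + 1 * - + f * σ′) 4q≡fσ (sym +σ≡Σs) ⟩
    + (f ℕ.* σ a j) + + 1 * - + f * + σ a j
      ≡⟨ cong (_+ + 1 * - + f * + σ a j) (ℤ.pos-* f (σ a j)) ⟩
    + f * + σ a j + + 1 * - + f * + σ a j
      ≡⟨ cancel (+ f) (+ σ a j) ⟩
    + 0 ∎
    where
    open ≡-Reasoning
    cancel : ∀ f σ → f * σ + + 1 * - f * σ ≡ + 0
    cancel = solve-∀
  V⊥α (suc i) = trans (lift-α (+ 0) (gramSchmidt s (suc i)))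
    (cong (λ t → + 4 * + 0 + t) (trans (diagForm-comm s (λ _ → + 1) (gramSchmidt s (suc i)))
                                (gramSchmidt-orthogonal s (λ _ → + 1) (suc i) (+ 1) (λ _ _ → refl))))

  V⊥β : ∀ i → Bℤ a β (V i) ≡ + 0
  V⊥β zero    = lift-β (+ q) (λ _ → - + f)
  V⊥β (suc i) = lift-β (+ 0) (gramSchmidt s (suc i))

  gram-< : ∀ {i i′} → toℕ i ℕ.< toℕ i′ → Bℤ a (V i) (V i′) ≡ + 0
  gram-< {zero}  {suc i′} _ =
    trans (lift-B (+ q) (λ _ → - + f) (+ 0) (gramSchmidt s (suc i′)))
          (trans (cong (λ t → + 6 * (+ q * + 0) + t)
                       (trans (diagForm-comm s (λ _ → - + f) (gramSchmidt s (suc i′)))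
                              (gramSchmidt-orthogonal s (λ _ → - + f) (suc i′) (- + f) (λ _ _ → refl))))
                 (vanish (+ q)))
    where
    vanish : ∀ q → + 6 * (q * + 0) + + 0 ≡ + 0
    vanish = solve-∀
  gram-< {suc i} {suc i′} (s≤s i<i′) =
    trans (lift-B (+ 0) (gramSchmidt s (suc i)) (+ 0) (gramSchmidt s (suc i′)))
          (cong (λ t → + 6 * (+ 0 * + 0) + t)
                (gramSchmidt-orthogonal s (gramSchmidt s (suc i′)) (suc i) (- s (suc i′))
                               (λ k k≤i → gramSchmidt-below s (ℕ.≤-<-trans k≤i (s≤s i<i′)))))

  b0≡ : b0 (σ a j) ≡ + 6 * (+ q * + q) + + f * + f * + σ a j
  b0≡ = begin
    sq (+ ((2 ℕ.* σ a j) /g4[ σ a j ])) + + 2 * sq (+ q) + + σ a j * sq (- + f)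
      ≡⟨ cong (λ x → sq (+ x) + + 2 * sq (+ q) + + σ a j * sq (- + f)) (*-/-assoc 2 (gcd[m,n]∣n 4 (σ a j))) ⟩
    sq (+ (2 ℕ.* q)) + + 2 * sq (+ q) + + σ a j * sq (- + f)
      ≡⟨ cong (λ x → sq x + + 2 * sq (+ q) + + σ a j * sq (- + f)) (ℤ.pos-* 2 q) ⟩
    sq (+ 2 * + q) + + 2 * sq (+ q) + + σ a j * sq (- + f)
      ≡⟨ collect (+ q) (+ f) (+ σ a j) ⟩
    + 6 * (+ q * + q) + + f * + f * + σ a j ∎
    where
    open ≡-Reasoning
    collect : ∀ q f σ → (+ 2 * q) * (+ 2 * q) + + 2 * (q * q) + σ * (- f * - f) ≡ + 6 * (q * q) + f * f * σ
    collect = solve-∀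

  gram-self : ∀ i → Bℤ a (V i) (V i) ≡ bcoef a j i
  gram-self zero = begin
    Bℤ a (V zero) (V zero)
      ≡⟨ lift-B (+ q) (λ _ → - + f) (+ q) (λ _ → - + f) ⟩
    + 6 * (+ q * + q) + diagForm s (λ _ → - + f) (λ _ → - + f)
      ≡⟨ cong (λ t → + 6 * (+ q * + q) + t)
              (trans (diagForm-constant s (- + f) (- + f)) (cong (- + f * - + f *_) (sym +σ≡Σs))) ⟩
    + 6 * (+ q * + q) + - + f * - + f * + σ a j
      ≡⟨ cong (λ t → + 6 * (+ q * + q) + t * + σ a j) (neg-square (+ f)) ⟩
    + 6 * (+ q * + q) + + f * + f * + σ a j
      ≡⟨ b0≡ ⟨
    b0 (σ a j) ∎
    where
    open ≡-Reasoning
    neg-square : ∀ x → - x * - x ≡ x * x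
    neg-square = solve-∀
  gram-self (suc i) = begin
    Bℤ a (V (suc i)) (V (suc i))
      ≡⟨ trans (lift-B (+ 0) (gramSchmidt s (suc i)) (+ 0) (gramSchmidt s (suc i)))
               (trans (ℤ.+-identityˡ (diagForm s (gramSchmidt s (suc i)) (gramSchmidt s (suc i))))
                      (gramSchmidt-norm s (suc i))) ⟩
    s (suc i) * prefix s (suc (toℕ i)) * prefix s (suc (suc (toℕ i)))
      ≡⟨ cong₂ (λ x y → s (suc i) * x * y) (sym (+S≡prefix (suc (toℕ i))))
                                             (sym (+S≡prefix (suc (suc (toℕ i))))) ⟩
    + a (j (suc i)) * + S a j (suc (toℕ i)) * + S a j (suc (suc (toℕ i)))
      ≡⟨ trans (cong (_* + S a j (suc (suc (toℕ i)))) (sym (ℤ.pos-* (a (j (suc i))) (S a j (suc (toℕ i))))))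
               (sym (ℤ.pos-* (a (j (suc i)) ℕ.* S a j (suc (toℕ i))) (S a j (suc (suc (toℕ i)))))) ⟩
    bcoef a j (suc i) ∎
    where open ≡-Reasoning

  gram : ∀ i i′ → Bℤ a (V i) (V i′) ≡ diagEntry (bcoef a j) i i′
  gram i i′ with i Fin.≟ i′
  ... | yes refl = trans (gram-self i) (sym (diagEntry-self (bcoef a j) i))
  ... | no  i≢i′ = trans off-diagonal (sym (diagEntry-≢ (bcoef a j) i≢i′))
    where
    off-diagonal : Bℤ a (V i) (V i′) ≡ + 0
    off-diagonal with Fin.<-cmp i i′
    ... | tri< i<i′ _ _ = gram-< i<i′
    ... | tri≈ _ i≡i′ _ = ⊥-elim (i≢i′ i≡i′)
    ... | tri> _ _ i′<i = trans (diagForm-comm (+_ ∘ a) (V i) (V i′)) (gram-< i′<i)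

  f-pos : 1 ≤ f
  f-pos = ℕ.n≢0⇒n>0 λ f≡0 →
    case trans (sym (m*[n/m]≡n (gcd[m,n]∣m 4 (σ a j)))) (trans (cong (g ℕ.*_) f≡0) (ℕ.*-zeroʳ g)) of λ ()

  b0-cast : b0 (σ a j) ≡ + (6 ℕ.* (q ℕ.* q) ℕ.+ f ℕ.* f ℕ.* σ a j)
  b0-cast = trans b0≡ (trans (cong₂ _+_ 6q²≡ f²σ≡) (sym (ℤ.pos-+ (6 ℕ.* (q ℕ.* q)) (f ℕ.* f ℕ.* σ a j))))
    where
    6q²≡ : + 6 * (+ q * + q) ≡ + (6 ℕ.* (q ℕ.* q))
    6q²≡ = trans (cong (+ 6 *_) (sym (ℤ.pos-* q q))) (sym (ℤ.pos-* 6 (q ℕ.* q)))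
    f²σ≡ : + f * + f * + σ a j ≡ + (f ℕ.* f ℕ.* σ a j)
    f²σ≡ = trans (cong (_* + σ a j) (sym (ℤ.pos-* f f))) (sym (ℤ.pos-* (f ℕ.* f) (σ a j)))

  bcoef≢0 : ∀ i → bcoef a j i ≢ + 0
  -- Matching on the index makes l a successor, so that σ a j = S a j (suc (ℕ.pred l)).
  bcoef≢0 zero    = subst (_≢ + 0) (sym b0-cast)
                      (pos≢0 (ℕ.≤-trans (ℕ.*-mono-≤ (ℕ.*-mono-≤ f-pos f-pos)
                                                    (S-suc-pos a j (a≥1 (j zero)) (ℕ.pred l)))
                                        (ℕ.m≤n+m _ _)))
  bcoef≢0 (suc i) = pos≢0 (ℕ.*-mono-≤ (ℕ.*-mono-≤ (a≥1 (j (suc i))) (S-suc-pos a j (a≥1 (j zero)) (toℕ i)))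
                                      (S-suc-pos a j (a≥1 (j zero)) (suc (toℕ i))))

  containsDiag : ∀ p → Prime p → ContainsDiag p a (bcoef a j)
  containsDiag p pr = integral⇒ContainsDiag pr a (bcoef a j) V V⊥α V⊥β gram bcoef≢0

evenUniversal₂-of-line : (a : Fin 10 → ℕ) (x y : Fin 10 → ℤ) (A B C : ℤ) →
  Bℤ a α x ≡ + 0 → Bℤ a β x ≡ + 0 → Bℤ a α y ≡ + 0 → Bℤ a β y ≡ + 0 →
  Qℤ a x ≡ + 2 * A → Bℤ a x y ≡ + 1 + + 2 * B → Qℤ a y ≡ + 4 * C → EvenUniversal₂ a
evenUniversal₂-of-line a x y A B C x⊥α x⊥β y⊥α y⊥β Qx≡ Bxy≡ Qy≡ d = point , point∈L , Q≡2d
  where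
  F : ℤ → ℤ
  F z = A + (+ 1 + + 2 * B) * z + + 2 * C * (z * z)

  F-slope : ∀ u v → + 2 * (u - v) ∣ℤ (u - v) - (F u - F v)
  F-slope u v = divides (- (B + C * (u + v))) (difference A B C u v)
    where
    difference : ∀ A B C u v →
      (u - v) - ((A + (+ 1 + + 2 * B) * u + + 2 * C * (u * u)) - (A + (+ 1 + + 2 * B) * v + + 2 * C * (v * v)))
        ≡ - (B + C * (u + v)) * (+ 2 * (u - v))
    difference = solve-∀

  open Hensel {2} F F-slope using (root; root-correct)

  point : Fin 10 → ℤ[ 2 ]
  point m = affine (x m) (y m) (root d)

  line : ℤ → Fin 10 → ℤ
  line z m = x m + z * y m

  line⊥ : ∀ w z → Bℤ a w x ≡ + 0 → Bℤ a w y ≡ + 0 → Bℤ a w (line z) ≡ + 0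
  line⊥ w z w⊥x w⊥y = trans (diagForm-linearʳ (+_ ∘ a) w x y z)
                            (trans (cong₂ (λ u v → u + z * v) w⊥x w⊥y)
                                   (trans (ℤ.+-identityˡ (z * + 0)) (ℤ.*-zeroʳ z)))

  Q-line : ∀ z → Qℤ a (line z) ≡ + 2 * F z
  Q-line z = begin
    Qℤ a (line z)
      ≡⟨ diagForm-line (+_ ∘ a) x y z ⟩
    Qℤ a x + + 2 * z * Bℤ a x y + z * z * Qℤ a y
      ≡⟨ cong₂ (λ u v → u + + 2 * z * v + z * z * Qℤ a y) Qx≡ Bxy≡ ⟩
    + 2 * A + + 2 * z * (+ 1 + + 2 * B) + z * z * Qℤ a y
      ≡⟨ cong (λ u → + 2 * A + + 2 * z * (+ 1 + + 2 * B) + z * z * u) Qy≡ ⟩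
    + 2 * A + + 2 * z * (+ 1 + + 2 * B) + z * z * (+ 4 * C)
      ≡⟨ factor A B C z ⟩
    + 2 * F z ∎
    where
    open ≡-Reasoning
    factor : ∀ A B C z → + 2 * A + + 2 * z * (+ 1 + + 2 * B) + z * z * (+ 4 * C)
                         ≡ + 2 * (A + (+ 1 + + 2 * B) * z + + 2 * C * (z * z))
    factor = solve-∀

  point∈L : InLp 2 a point
  point∈L k = ≡⇒≡[mod] (line⊥ α (at (root d) k) x⊥α y⊥α)
            , ≡⇒≡[mod] (line⊥ β (at (root d) k) x⊥β y⊥β)

  Q≡2d : ∀ k → Qℤ a (lvl point k) ≡ + 2 * at d k [mod 2 ^ k ]
  Q≡2d k = ∣⇒[mod] (Qℤ a (line z)) (+ 2 * at d k)
    (∣-respʳ (trans (distrib (F z) (at d k)) (cong (_- + 2 * at d k) (sym (Q-line z))))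
      (ℤ∣.∣n⇒∣m*n (+ 2) ([mod]⇒∣ (F z) (at d k) (root-correct d k))))
    where
    z = at (root d) k
    distrib : ∀ F d → + 2 * (F - d) ≡ + 2 * F - + 2 * d
    distrib = solve-∀

odd-line-values : ∀ {u v w} U t W → u ≡ + 2 * U + + 1 → v ≡ u + + 4 * t → w ≡ + 2 * W + + 1 →
  ∃ λ A → ∃ λ B → ∃ λ C → (u * w * (u + w) ≡ + 2 * A)
                        × (u * w * (v + + 4) ≡ + 1 + + 2 * B)
                        × (+ 6 * (w * w) + u * v * (u + v) + + 16 * w ≡ + 4 * C)
odd-line-values U t W refl refl refl =
  A , B , C , Q₀-identity U W , B-identity U t W , Q₁-identity U t W
  where
  u w X Y X′ Y′ A B C : ℤ
  u = + 2 * U + + 1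
  w = + 2 * W + + 1
  X = + 2 * U * W + U + W
  Y = U + + 2 * t + + 2
  X′ = + 2 * U + + 2 * t + + 2 * U * (U + + 2 * t)
  Y′ = U + t
  A = u * w * (U + W + + 1)
  B = X + Y + + 2 * X * Y
  C = + 6 * (W * W) + + 14 * W + + 6 + (X′ + Y′ + + 2 * X′ * Y′)
  Q₀-identity : ∀ U W → let u = + 2 * U + + 1 ; w = + 2 * W + + 1 in
    u * w * (u + w) ≡ + 2 * (u * w * (U + W + + 1))
  Q₀-identity = solve-∀
  B-identity : ∀ U t W → let u = + 2 * U + + 1 ; w = + 2 * W + + 1
                             X = + 2 * U * W + U + W ; Y = U + + 2 * t + + 2 in
    u * w * (u + + 4 * t + + 4) ≡ + 1 + + 2 * (X + Y + + 2 * X * Y)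
  B-identity = solve-∀
  Q₁-identity : ∀ U t W → let u = + 2 * U + + 1 ; v = u + + 4 * t ; w = + 2 * W + + 1
                              X = + 2 * U + + 2 * t + + 2 * U * (U + + 2 * t) ; Y = U + t in
    + 6 * (w * w) + u * v * (u + v) + + 16 * w
      ≡ + 4 * (+ 6 * (W * W) + + 14 * W + + 6 + (X + Y + + 2 * X * Y))
  Q₁-identity = solve-∀

evenUniversal₂-of-odd-triple : (a : Fin 10 → ℕ) → a zero ≡ 1 → a (suc zero) ≡ 2 →
  (j : Fin 3 → Fin 10) → Injective _≡_ _≡_ j → (∀ k → 2 ≤ toℕ (j k)) →
  ∀ U t W → + a (j zero) ≡ + 2 * U + + 1 → + a (j (suc zero)) ≡ + a (j zero) + + 4 * t →
  + a (j (suc (suc zero))) ≡ + 2 * W + + 1 → EvenUniversal₂ a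
evenUniversal₂-of-odd-triple a a₀≡1 a₁≡2 j j-inj j≥2 U t W u≡ v≡ w≡
  with odd-line-values U t W u≡ v≡ w≡
... | A , B , C , Q₀≡ , B₀₁≡ , Q₁≡ =
  evenUniversal₂-of-line a x₀ x₁ A B C
    (trans (lift-α (+ 0) y₀) (α₀ u v w)) (lift-β (+ 0) y₀)
    (trans (lift-α w y₁) (α₁ u v w)) (lift-β w y₁)
    (trans (lift-B (+ 0) y₀ (+ 0) y₀) (trans (tidy-Q₀ u v w) Q₀≡))
    (trans (lift-B (+ 0) y₀ w y₁) (trans (tidy-B u v w) B₀₁≡))
    (trans (lift-B w y₁ w y₁) (trans (tidy-Q₁ u v w) Q₁≡))
  where
  open Coordinates a a₀≡1 a₁≡2 j j-inj j≥2
  u v w : ℤ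
  u = s zero
  v = s (suc zero)
  w = s (suc (suc zero))
  -- x₀ + z x₁ is the line (t, y) = (wz, (w + vz, −uz, −u − 4z)).
  y₀ y₁ : Vector ℤ 3
  y₀ = w ∷ + 0 ∷ - u ∷ []
  y₁ = v ∷ - u ∷ - + 4 ∷ []
  x₀ x₁ : Fin 10 → ℤ
  x₀ = lift (+ 0) y₀
  x₁ = lift w y₁
  α₀ : ∀ u v w → + 4 * + 0 + (u * (+ 1 * w) + (v * (+ 1 * + 0) + (w * (+ 1 * - u) + + 0))) ≡ + 0
  α₀ = solve-∀
  α₁ : ∀ u v w → + 4 * w + (u * (+ 1 * v) + (v * (+ 1 * - u) + (w * (+ 1 * - + 4) + + 0))) ≡ + 0
  α₁ = solve-∀
  tidy-Q₀ : ∀ u v w → + 6 * (+ 0 * + 0) + (u * (w * w) + (v * (+ 0 * + 0) + (w * (- u * - u) + + 0)))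
                      ≡ u * w * (u + w)
  tidy-Q₀ = solve-∀
  tidy-B : ∀ u v w → + 6 * (+ 0 * w) + (u * (w * v) + (v * (+ 0 * - u) + (w * (- u * - + 4) + + 0)))
                     ≡ u * w * (v + + 4)
  tidy-B = solve-∀
  tidy-Q₁ : ∀ u v w → + 6 * (w * w) + (u * (v * v) + (v * (- u * - u) + (w * (- + 4 * - + 4) + + 0)))
                      ≡ + 6 * (w * w) + u * v * (u + v) + + 16 * w
  tidy-Q₁ = solve-∀

evenUniversal₂-of-residues : (a : Fin 10 → ℕ) → a zero ≡ 1 → a (suc zero) ≡ 2 →
  (j : Fin 3 → Fin 10) → Injective _≡_ _≡_ j → (∀ k → 2 ≤ toℕ (j k)) →
  ∀ m₀ m₁ m₂ b b′ → + a (j zero) ≡ + 4 * m₀ + (+ 2 * bit b + + 1) →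
  + a (j (suc zero)) ≡ + 4 * m₁ + (+ 2 * bit b + + 1) →
  + a (j (suc (suc zero))) ≡ + 4 * m₂ + (+ 2 * bit b′ + + 1) → EvenUniversal₂ a
evenUniversal₂-of-residues a a₀≡1 a₁≡2 j j-inj j≥2 m₀ m₁ m₂ b b′ e₀ e₁ e₂ =
  evenUniversal₂-of-odd-triple a a₀≡1 a₁≡2 j j-inj j≥2 (+ 2 * m₀ + bit b) (m₁ - m₀) (+ 2 * m₂ + bit b′)
    (trans e₀ (halve m₀ (bit b)))
    (trans e₁ (trans (shift m₀ m₁ (bit b)) (cong (_+ + 4 * (m₁ - m₀)) (sym e₀))))
    (trans e₂ (halve m₂ (bit b′)))
  where
  halve : ∀ m c → + 4 * m + (+ 2 * c + + 1) ≡ + 2 * (+ 2 * m + c) + + 1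
  halve = solve-∀
  shift : ∀ m₀ m₁ c → + 4 * m₁ + (+ 2 * c + + 1) ≡ + 4 * m₀ + (+ 2 * c + + 1) + + 4 * (m₁ - m₀)
  shift = solve-∀

evenUniversal₂-of-odd-positions : (a : Fin 10 → ℕ) → a zero ≡ 1 → a (suc zero) ≡ 2 →
  (o : Fin 3 → Fin 10) → Injective _≡_ _≡_ o → (∀ k → 2 ≤ toℕ (o k)) →
  (∀ k → T (a (o k) % 2 ≡ᵇ 1)) → EvenUniversal₂ a
evenUniversal₂-of-odd-positions a a₀≡1 a₁≡2 o o-inj o≥2 o-odd =
  evenUniversal₂-of-residues a a₀≡1 a₁≡2 (o ∘ π) (perm-injective (proj₁ agreement) ∘ o-inj) (o≥2 ∘ π)
    (m (π zero)) (m (π (suc zero))) (m (π (suc (suc zero)))) (b (π zero)) (b (π (suc (suc zero))))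
    (e (π zero)) (subst (λ c → + a (o (π (suc zero))) ≡ + 4 * m (π (suc zero)) + (+ 2 * bit c + + 1))
                        (sym (proj₂ agreement)) (e (π (suc zero))))
    (e (π (suc (suc zero))))
  where
  form : ∀ k → ∃ λ m → ∃ λ b → + a (o k) ≡ + 4 * m + (+ 2 * bit b + + 1)
  form k = odd-form (a (o k)) (o-odd k)
  m : Fin 3 → ℤ
  m k = proj₁ (form k)
  b : Fin 3 → Bool
  b k = proj₁ (proj₂ (form k))
  e : ∀ k → + a (o k) ≡ + 4 * m k + (+ 2 * bit (b k) + + 1)
  e k = proj₂ (proj₂ (form k))
  agreement : ∃ λ (π : Permutation′ 3) → b (π ⟨$⟩ʳ zero) ≡ b (π ⟨$⟩ʳ suc zero)
  agreement = agreeing-pair b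
  π : Fin 3 → Fin 3
  π = proj₁ agreement ⟨$⟩ʳ_

evenUniversal₂-of-oddCount : (a : Fin 10 → ℕ) → a zero ≡ 1 → a (suc zero) ≡ 2 →
                             3 ≤ oddCount a → EvenUniversal₂ a
evenUniversal₂-of-oddCount a a₀≡1 a₁≡2 3≤odd
  with select (λ i → (1 <ᵇ toℕ i) ∧ (a i % 2 ≡ᵇ 1)) 3 3≤odd
... | o , o-inj , o-ok = evenUniversal₂-of-odd-positions a a₀≡1 a₁≡2 o o-inj
                           (λ k → ℕ.<ᵇ⇒< 1 (toℕ (o k)) (proj₁ (Equivalence.to Bool.T-∧ (o-ok k))))
                           (λ k → proj₂ (Equivalence.to Bool.T-∧ (o-ok k)))

lemma4p7 : (a : Fin 10 → ℕ) → (∀ i → 1 ≤ a i) → a zero ≡ 1 → a (suc zero) ≡ 2 →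
    (Bℤ a α β ≡ + 1)
    × (3 ≤ oddCount a → EvenUniversal₂ a)
    × ((l : ℕ) (j : Fin l → Fin 10) → Injective _≡_ _≡_ j → (∀ k → 2 ≤ toℕ (j k)) →
         (p : ℕ) → Prime p → ContainsDiag p a (bcoef a j))
lemma4p7 a a≥1 a₀≡1 a₁≡2 =
    B[α,β]≡1 a a₀≡1 a₁≡2
  , evenUniversal₂-of-oddCount a a₀≡1 a₁≡2
  , λ l j j-inj j≥2 → DiagonalSublattice.containsDiag a a≥1 a₀≡1 a₁≡2 j j-inj j≥2
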